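{- Let $q$ be a positive integer, $A_q=(c_q(m-n))_{m,n=1}^q$ and $B_q=(S(m,n;q))_{m,n=1}^q$. Then $B_q^2=qA_q$.
   Context: For a positive integer $q$ and any integer $n$, the Ramanujan sum is $c_q(n)=\sum_{1\le k\le q,\ \gcd(k,q)=1}\exp(2\pi i kn/q)$. For integers $m,n$, the Kloosterman sum is $S(m,n;q)=\sum_{1\le k\le q,\ \gcd(k,q)=1}\exp\bigl(\frac{2\pi i}{q}(mk+nk^*)\bigr)$, where $k^*$ denotes an inverse of $k$ modulo $q$. -}

module Defs where

open import Level using (Level)
open import Algebra.Bundles using (CommutativeRing)
open import Data.Nat using (ℕ; zero; suc; NonZero)
open import Data.Nat.Divisibility using (_∣_)
open import Data.Nat.GCD using (gcd)
open import Data.Integer using (ℤ; +_)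
open import Data.Integer.DivMod using (_%_)
open import Data.List using (List; []; _∷_; foldr; map; filter; upTo)
open import Relation.Nullary using (¬_)
open import Data.Product using (_×_)
import Data.Nat as ℕ
import Data.Integer as ℤ

-- Everything is done inside an arbitrary commutative ring R with a
-- distinguished element ζ, which plays the role of exp(2πi/q).
module InRing {c ℓ : Level} (R : CommutativeRing c ℓ) where
  open CommutativeRing R

  pow : Carrier → ℕ → Carrier
  pow x zero = 1#
  pow x (suc n) = x * pow x n

  fromℕ : ℕ → Carrier
  fromℕ zero = 0#
  fromℕ (suc n) = 1# + fromℕ n

  Σ : List ℕ → (ℕ → Carrier) → Carrier
  Σ xs f = foldr (λ x acc → f x + acc) 0# xs

  range1 : ℕ → List ℕ
  range1 q = map suc (upTo q)

  units : ℕ → List ℕ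
  units q = filter (λ k → gcd k q ℕ.≟ 1) (range1 q)

  module WithRoot (q : ℕ) .{{_ : NonZero q}} (ζ : Carrier) where

    e : ℤ → Carrier
    e t = pow ζ (t % (+ q))

    ramanujan : ℤ → Carrier
    ramanujan n = Σ (units q) (λ k → e (+ k ℤ.* n))

    -- Kloosterman sum S(m,n;q) = Σ_{1≤k≤q,(k,q)=1} e(mk + n k*),
    -- where k* runs over the (unique) inverse of k modulo q in 1..q
    inverses : ℕ → List ℕ
    inverses k = filter (λ l → (k ℕ.* l) ℕ.% q ℕ.≟ 1 ℕ.% q) (range1 q)

    kloosterman : ℤ → ℤ → Carrier
    kloosterman m n =
      Σ (units q) (λ k → Σ (inverses k) (λ kinv → e (m ℤ.* + k ℤ.+ n ℤ.* + kinv)))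

    Bsq : ℕ → ℕ → Carrier
    Bsq m n = Σ (range1 q) (λ k → kloosterman (+ m) (+ k) * kloosterman (+ k) (+ n))

    qA : ℕ → ℕ → Carrier
    qA m n = fromℕ q * ramanujan (+ m ℤ.- + n)

  IsPrimitiveRoot : (q : ℕ) → Carrier → Set ℓ
  IsPrimitiveRoot q ζ =
    (pow ζ q ≈ 1#) ×
    ((k : ℕ) → ¬ (q ∣ k) → Σ (upTo q) (λ j → pow ζ (j ℕ.* k)) ≈ 0#)

{-# OPTIONS --safe #-}
-- Expanding both Kloosterman sums,
--   Σₖ S(m,k;q) S(k,n;q) = Σ_{aa' ≡ 1, bb' ≡ 1} e(ma + nb') Σₖ e(k(a' + b)),
-- and orthogonality of the characters k ↦ e(kc) turns the inner sum into q·[b ≡ −a'].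
-- Then b' ≡ −a is forced, the pairs (a, a') are counted by the units a, and what
-- remains is q Σ_{(a,q)=1} e(a(m − n)) = q c_q(m − n).
module Submission where

open import Defs
open import Level using (Level; 0ℓ)
open import Algebra.Bundles using (CommutativeRing)
open import Data.Nat using (ℕ; NonZero; _≤_)
import Data.Nat as ℕ
import Data.Nat.Properties as ℕ
open import Data.Nat.DivMod
  using (%-distribˡ-+; %-distribˡ-*; m%n%n≡m%n; n%n≡0; m*n%n≡0; m%n<n; m<n⇒m%n≡m; m≡m%n+[m/n]*n; [m+kn]%n≡m%n)
open import Data.Nat.Divisibility using (_∣_; n∣m⇒m%n≡0; ∣1⇒≡1; ∣m∣n⇒∣m+n; ∣m⇒∣m*n; ∣n⇒∣m*n; %-presˡ-∣)
open import Data.Nat.GCD using (gcd; gcd[m,n]∣m; gcd[m,n]∣n; module Bézout)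
open import Data.Nat.Coprimality using (gcd≡1⇒coprime; coprime-Bézout)
import Data.Nat.Tactic.RingSolver as ℕ-Solver
open import Data.Integer as ℤ using (ℤ; +_; -[1+_])
import Data.Integer.Properties as ℤ
open import Data.Integer.DivMod using (a≡a%n+[a/n]*n)
import Data.Integer.Tactic.RingSolver as ℤ-Solver
open import Data.Fin using (Fin; toℕ; fromℕ<; punchIn)
open import Data.Fin.Properties using (toℕ<n; toℕ-injective; toℕ-fromℕ<; punchInᵢ≢i)
open import Data.List using ([]; _∷_; map; filter; applyUpTo; upTo)
open import Data.Product using (∃; _,_; proj₁; proj₂)
open import Function using (_∘_; id; _⇔_; mk⇔; Equivalence)
open import Relation.Nullary using (Dec; yes; no; ¬_; contradiction)
import Relation.Unary as U
open import Relation.Binary.Core using (Rel)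
open import Relation.Binary.Definitions using (Decidable)
open import Relation.Binary.PropositionalEquality using (_≡_; _≢_; module ≡-Reasoning)
import Relation.Binary.PropositionalEquality as ≡
import Algebra.Properties.Group as GroupProperties
import Algebra.Properties.Ring as RingProperties
import Algebra.Properties.Semiring.Sum as SemiringSum
import Algebra.Properties.CommutativeSemigroup as CommutativeSemigroupProperties
import Algebra.Solver.Ring.NaturalCoefficients.Default as NaturalCoefficientsSolver
import Relation.Binary.Reasoning.Setoid as SetoidReasoning

module IntegerIdentities where
  open import Data.Integer using (_+_; _*_; _-_; -_)

  t≡[t+dk]-dk : ∀ t d k → t ≡ (t + d * k) + - d * k
  t≡[t+dk]-dk = ℤ-Solver.solve-∀

  r≡[r+wk+vk]-[w+v]k : ∀ r w v k → r ≡ ((r + w * k) + v * k) + - (w + v) * k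
  r≡[r+wk+vk]-[w+v]k = ℤ-Solver.solve-∀

  pos-linear : ∀ a b c d → + (a ℕ.* b ℕ.+ c ℕ.* d) ≡ + a * + b + + c * + d
  pos-linear a b c d = ≡.trans (ℤ.pos-+ (a ℕ.* b) (c ℕ.* d)) (≡.cong₂ _+_ (ℤ.pos-* a b) (ℤ.pos-* c d))

  a[m-n]+n[a+b]≡ma+nb : ∀ a m n b → + a * (+ m - + n) + + (n ℕ.* (a ℕ.+ b)) ≡ + (m ℕ.* a ℕ.+ n ℕ.* b)
  a[m-n]+n[a+b]≡ma+nb a m n b = begin
    + a * (+ m - + n) + + (n ℕ.* (a ℕ.+ b))    ≡⟨ ≡.cong (λ s → + a * (+ m - + n) + s) +[n[a+b]]≡n[a+b] ⟩
    + a * (+ m - + n) + + n * (+ a + + b)      ≡⟨ ring-identity (+ a) (+ m) (+ n) (+ b) ⟩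
    + m * + a + + n * + b                      ≡⟨ pos-linear m a n b ⟨
    + (m ℕ.* a ℕ.+ n ℕ.* b)                    ∎
    where
    open ≡-Reasoning
    +[n[a+b]]≡n[a+b] : + (n ℕ.* (a ℕ.+ b)) ≡ + n * (+ a + + b)
    +[n[a+b]]≡n[a+b] = ≡.trans (ℤ.pos-* n (a ℕ.+ b)) (≡.cong (+ n *_) (ℤ.pos-+ a b))
    ring-identity : ∀ a m n b → a * (m - n) + n * (a + b) ≡ m * a + n * b
    ring-identity = ℤ-Solver.solve-∀

open IntegerIdentities

module Sums {c ℓ : Level} (R : CommutativeRing c ℓ) where
  open CommutativeRing R
  open InRing R using (Σ; fromℕ)
  open SemiringSum semiring public using (sum; sum-syntax; ∑-comm; *-distribˡ-sum; *-distribʳ-sum; sum-cong-≋)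
  open SemiringSum semiring using (sum-remove; sum-replicate-zero)
  open SetoidReasoning setoid

  𝟙 : ∀ {a} {A : Set a} → Dec A → Carrier
  𝟙 (yes _) = 1#
  𝟙 (no _)  = 0#

  module _ {a} {A : Set a} where

    𝟙-no : (a? : Dec A) → ¬ A → 𝟙 a? ≈ 0#
    𝟙-no (yes p) ¬p = contradiction p ¬p
    𝟙-no (no _)  _  = refl

    𝟙-*-yes : (a? : Dec A) {x : Carrier} → A → 𝟙 a? * x ≈ x
    𝟙-*-yes (yes _) _ = *-identityˡ _
    𝟙-*-yes (no ¬p) p = contradiction p ¬p

    𝟙-*-no : (a? : Dec A) {x : Carrier} → ¬ A → 𝟙 a? * x ≈ 0#
    𝟙-*-no a? ¬p = trans (*-congʳ (𝟙-no a? ¬p)) (zeroˡ _)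

    𝟙-*-cong : (a? : Dec A) {x y : Carrier} → (A → x ≈ y) → 𝟙 a? * x ≈ 𝟙 a? * y
    𝟙-*-cong (yes p) x≈y = *-congˡ (x≈y p)
    𝟙-*-cong (no _)  _   = trans (zeroˡ _) (sym (zeroˡ _))

  𝟙-cong : ∀ {a b} {A : Set a} {B : Set b} (a? : Dec A) (b? : Dec B) → A ⇔ B → 𝟙 a? ≈ 𝟙 b?
  𝟙-cong (yes _) (yes _) _   = refl
  𝟙-cong (yes p) (no ¬q) A⇔B = contradiction (Equivalence.to A⇔B p) ¬q
  𝟙-cong (no ¬p) (yes q) A⇔B = contradiction (Equivalence.from A⇔B q) ¬p
  𝟙-cong (no _)  (no _)  _   = refl

  ∑-δ : ∀ {n} (f : Fin n → Carrier) i → (∀ j → j ≢ i → f j ≈ 0#) → sum f ≈ f i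
  ∑-δ {ℕ.suc n} f i f≈0 = begin
    sum f                             ≈⟨ sum-remove f ⟩
    f i + ∑[ j < n ] f (punchIn i j)  ≈⟨ +-congˡ (trans (sum-cong-≋ (λ j → f≈0 _ (punchInᵢ≢i i j)))
                                                         (sum-replicate-zero n)) ⟩
    f i + 0#                          ≈⟨ +-identityʳ (f i) ⟩
    f i                               ∎

  ∑-1# : ∀ n → ∑[ i < n ] 1# ≈ fromℕ n
  ∑-1# ℕ.zero    = refl
  ∑-1# (ℕ.suc n) = +-congˡ (∑-1# n)

  ∑-rotate : ∀ n (f : ℕ → Carrier) → f 0 + ∑[ i < n ] f (ℕ.suc (toℕ i)) ≈ ∑[ i < n ] f (toℕ i) + f n
  ∑-rotate ℕ.zero    f = +-comm (f 0) 0#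
  ∑-rotate (ℕ.suc n) f = begin
    f 0 + (f 1 + ∑[ i < n ] f (2 ℕ.+ toℕ i))            ≈⟨ +-congˡ (∑-rotate n (f ∘ ℕ.suc)) ⟩
    f 0 + (∑[ i < n ] f (ℕ.suc (toℕ i)) + f (ℕ.suc n))  ≈⟨ +-assoc (f 0) _ _ ⟨
    (f 0 + ∑[ i < n ] f (ℕ.suc (toℕ i))) + f (ℕ.suc n)  ∎

  ∑-shift : ∀ n (f : ℕ → Carrier) → f n ≈ f 0 → ∑[ i < n ] f (ℕ.suc (toℕ i)) ≈ ∑[ i < n ] f (toℕ i)
  ∑-shift n f fn≈f0 = ∙-cancelˡ (f 0) _ _ (begin
    f 0 + ∑[ i < n ] f (ℕ.suc (toℕ i)) ≈⟨ ∑-rotate n f ⟩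
    ∑[ i < n ] f (toℕ i) + f n         ≈⟨ +-congˡ fn≈f0 ⟩
    ∑[ i < n ] f (toℕ i) + f 0         ≈⟨ +-comm _ (f 0) ⟩
    f 0 + ∑[ i < n ] f (toℕ i)         ∎)
    where open GroupProperties +-group using (∙-cancelˡ)

  ∑-product-comm : ∀ {k m n} (f : Fin k → Fin m → Carrier) (g : Fin k → Fin n → Carrier) →
    ∑[ t < k ] (∑[ i < m ] f t i * ∑[ j < n ] g t j) ≈ ∑[ i < m ] ∑[ j < n ] ∑[ t < k ] (f t i * g t j)
  ∑-product-comm {k} {m} {n} f g = begin
    ∑[ t < k ] (∑[ i < m ] f t i * ∑[ j < n ] g t j)
      ≈⟨ sum-cong-≋ (λ t → trans (*-distribʳ-sum _ (f t)) (sum-cong-≋ (λ i → *-distribˡ-sum (f t i) (g t)))) ⟩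
    ∑[ t < k ] ∑[ i < m ] ∑[ j < n ] (f t i * g t j)   ≈⟨ ∑-comm (λ t i → ∑[ j < n ] (f t i * g t j)) ⟩
    ∑[ i < m ] ∑[ t < k ] ∑[ j < n ] (f t i * g t j)   ≈⟨ sum-cong-≋ (λ i → ∑-comm (λ t j → f t i * g t j)) ⟩
    ∑[ i < m ] ∑[ j < n ] ∑[ t < k ] (f t i * g t j)   ∎

  Σ-cong : ∀ xs {f g : ℕ → Carrier} → (∀ x → f x ≈ g x) → Σ xs f ≈ Σ xs g
  Σ-cong []       f≈g = refl
  Σ-cong (x ∷ xs) f≈g = +-cong (f≈g x) (Σ-cong xs f≈g)

  Σ-map : ∀ (g : ℕ → ℕ) xs (f : ℕ → Carrier) → Σ (map g xs) f ≈ Σ xs (f ∘ g)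
  Σ-map g []       f = refl
  Σ-map g (x ∷ xs) f = +-congˡ (Σ-map g xs f)

  Σ-applyUpTo : ∀ (g : ℕ → ℕ) n (f : ℕ → Carrier) → Σ (applyUpTo g n) f ≈ ∑[ i < n ] f (g (toℕ i))
  Σ-applyUpTo g ℕ.zero    f = refl
  Σ-applyUpTo g (ℕ.suc n) f = +-congˡ (Σ-applyUpTo (g ∘ ℕ.suc) n f)

  Σ-filter : ∀ {p} {P : U.Pred ℕ p} (P? : U.Decidable P) xs (f : ℕ → Carrier) →
             Σ (filter P? xs) f ≈ Σ xs (λ x → 𝟙 (P? x) * f x)
  Σ-filter P? []       f = refl
  Σ-filter P? (x ∷ xs) f with P? x
  ... | yes _ = +-cong (sym (*-identityˡ (f x))) (Σ-filter P? xs f)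
  ... | no _  = trans (Σ-filter P? xs f) (sym (trans (+-congʳ (zeroˡ (f x))) (+-identityˡ _)))

module Residues (q : ℕ) .{{_ : NonZero q}} where
  open import Data.Nat using (_+_; _*_; _∸_; _%_; _/_; _≟_; suc)
  open ≡ using (refl; sym; trans; cong; cong₂; subst)

  infix 4 _≋_ _≋?_

  _≋_ : Rel ℕ 0ℓ
  x ≋ y = x % q ≡ y % q

  _≋?_ : Decidable _≋_
  x ≋? y = x % q ≟ y % q

  neg : ℕ → ℕ
  neg x = q ∸ x % q

  ≡⇒≋ : ∀ {x y} → x ≡ y → x ≋ y
  ≡⇒≋ = cong (_% q)

  %-≋ : ∀ x → x % q ≋ x
  %-≋ x = m%n%n≡m%n x q

  0%q≡0 : 0 % q ≡ 0
  0%q≡0 = m*n%n≡0 0 q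

  q≋0 : q ≋ 0
  q≋0 = trans (n%n≡0 q) (sym 0%q≡0)

  +-cong-≋ : ∀ {a b c d} → a ≋ b → c ≋ d → a + c ≋ b + d
  +-cong-≋ {a} {b} {c} {d} a≋b c≋d = begin
    (a + c) % q              ≡⟨ %-distribˡ-+ a c q ⟩
    (a % q + c % q) % q      ≡⟨ cong₂ (λ u v → (u + v) % q) a≋b c≋d ⟩
    (b % q + d % q) % q      ≡⟨ %-distribˡ-+ b d q ⟨
    (b + d) % q              ∎
    where open ≡-Reasoning

  *-cong-≋ : ∀ {a b c d} → a ≋ b → c ≋ d → a * c ≋ b * d
  *-cong-≋ {a} {b} {c} {d} a≋b c≋d = begin
    (a * c) % q              ≡⟨ %-distribˡ-* a c q ⟩
    (a % q * (c % q)) % q    ≡⟨ cong₂ (λ u v → (u * v) % q) a≋b c≋d ⟩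
    (b % q * (d % q)) % q    ≡⟨ %-distribˡ-* b d q ⟨
    (b * d) % q              ∎
    where open ≡-Reasoning

  neg-inverseˡ : ∀ x → neg x + x ≋ 0
  neg-inverseˡ x = begin
    (neg x + x) % q          ≡⟨ +-cong-≋ {neg x} refl (%-≋ x) ⟨
    (neg x + x % q) % q      ≡⟨ cong (_% q) (ℕ.m∸n+n≡m (ℕ.<⇒≤ (m%n<n x q))) ⟩
    q % q                    ≡⟨ q≋0 ⟩
    0 % q                    ∎
    where open ≡-Reasoning

  +r≡+t+dq⇒r≋t : ∀ r t (d : ℤ) → + r ≡ + t ℤ.+ d ℤ.* + q → r ≋ t
  +r≡+t+dq⇒r≋t r t (+ j) r≡t+jq =
    trans (≡⇒≋ (ℤ.+-injective (trans r≡t+jq (sym +[t+jq]≡t+jq)))) ([m+kn]%n≡m%n t j q)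
    where
    +[t+jq]≡t+jq : + (t + j * q) ≡ + t ℤ.+ + j ℤ.* + q
    +[t+jq]≡t+jq = trans (ℤ.pos-+ t (j * q)) (cong (λ u → + t ℤ.+ u) (ℤ.pos-* j q))
  +r≡+t+dq⇒r≋t r t d@(-[1+ j ]) r≡t+dq = sym (+r≡+t+dq⇒r≋t t r (ℤ.- d)
    (trans (t≡[t+dk]-dk (+ t) d (+ q)) (cong (λ u → u ℤ.+ ℤ.- d ℤ.* + q) (sym r≡t+dq))))

  x+s≡t⇒x%q≋t : ∀ x t s → x ℤ.+ + s ≡ + t → s ≋ 0 → x ℤ.% + q ≋ t
  x+s≡t⇒x%q≋t x t s x+s≡t s≋0 = +r≡+t+dq⇒r≋t r t (ℤ.- (w ℤ.+ + v)) r≡t-[w+v]q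
    where
    open ≡-Reasoning
    r = x ℤ.% + q
    w = x ℤ./ + q
    v = s / q
    s≡vq : + s ≡ + v ℤ.* + q
    s≡vq = begin
      + s                     ≡⟨ cong +_ (m≡m%n+[m/n]*n s q) ⟩
      + (s % q + v * q)       ≡⟨ cong (λ u → + (u + v * q)) (trans s≋0 0%q≡0) ⟩
      + (v * q)               ≡⟨ ℤ.pos-* v q ⟩
      + v ℤ.* + q             ∎
    r≡t-[w+v]q : + r ≡ + t ℤ.+ ℤ.- (w ℤ.+ + v) ℤ.* + q
    r≡t-[w+v]q = begin
      + r                                                          ≡⟨ r≡[r+wk+vk]-[w+v]k (+ r) w (+ v) (+ q) ⟩
      ((+ r ℤ.+ w ℤ.* + q) ℤ.+ + v ℤ.* + q) ℤ.+ ℤ.- (w ℤ.+ + v) ℤ.* + q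
        ≡⟨ cong₂ (λ y z → (y ℤ.+ z) ℤ.+ ℤ.- (w ℤ.+ + v) ℤ.* + q) (sym (a≡a%n+[a/n]*n x (+ q))) (sym s≡vq) ⟩
      (x ℤ.+ + s) ℤ.+ ℤ.- (w ℤ.+ + v) ℤ.* + q
        ≡⟨ cong (λ y → y ℤ.+ ℤ.- (w ℤ.+ + v) ℤ.* + q) x+s≡t ⟩
      + t ℤ.+ ℤ.- (w ℤ.+ + v) ℤ.* + q                              ∎

  ℤ/q : CommutativeRing 0ℓ 0ℓ
  ℤ/q = record
    { Carrier = ℕ ; _≈_ = _≋_ ; _+_ = _+_ ; _*_ = _*_ ; -_ = neg ; 0# = 0 ; 1# = 1
    ; isCommutativeRing = record
      { isRing = record
        { +-isAbelianGroup = record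
          { isGroup = record
            { isMonoid = record
              { isSemigroup = record
                { isMagma = record
                  { isEquivalence = record { refl = refl ; sym = sym ; trans = trans }
                  ; ∙-cong = +-cong-≋ }
                ; assoc = λ x y z → ≡⇒≋ (ℕ.+-assoc x y z) }
              ; identity = (λ _ → refl) , (λ x → ≡⇒≋ (ℕ.+-identityʳ x)) }
            ; inverse = neg-inverseˡ , (λ x → trans (≡⇒≋ (ℕ.+-comm x (neg x))) (neg-inverseˡ x))
            ; ⁻¹-cong = cong (λ r → (q ∸ r) % q) }
          ; comm = λ x y → ≡⇒≋ (ℕ.+-comm x y) }
        ; *-cong = *-cong-≋
        ; *-assoc = λ x y z → ≡⇒≋ (ℕ.*-assoc x y z)
        ; *-identity = (λ x → ≡⇒≋ (ℕ.*-identityˡ x)) , (λ x → ≡⇒≋ (ℕ.*-identityʳ x))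
        ; distrib = (λ x y z → ≡⇒≋ (ℕ.*-distribˡ-+ x y z)) , (λ x y z → ≡⇒≋ (ℕ.*-distribʳ-+ x y z)) }
      ; *-comm = λ x y → ≡⇒≋ (ℕ.*-comm x y) } }

  private
    module ℤq = CommutativeRing ℤ/q
    module ℤqGroup = GroupProperties ℤq.+-group
    module ℤqRing = RingProperties ℤq.ring
    open SetoidReasoning ℤq.setoid

  suc-≋-injective : ∀ (i j : Fin q) → suc (toℕ i) ≋ suc (toℕ j) → i ≡ j
  suc-≋-injective i j 1+i≋1+j = toℕ-injective
    (trans (sym (m<n⇒m%n≡m (toℕ<n i))) (trans (ℤqGroup.∙-cancelˡ 1 (toℕ i) (toℕ j) 1+i≋1+j) (m<n⇒m%n≡m (toℕ<n j))))

  representative : ∀ x → ∃ λ (i : Fin q) → suc (toℕ i) ≋ x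
  representative x = fromℕ< (m%n<n (x + ℕ.pred q) q) , (begin
    suc (toℕ (fromℕ< (m%n<n (x + ℕ.pred q) q)))  ≡⟨ cong suc (toℕ-fromℕ< _) ⟩
    suc ((x + ℕ.pred q) % q)                     ≈⟨ +-cong-≋ {1} refl (%-≋ (x + ℕ.pred q)) ⟩
    suc (x + ℕ.pred q)                           ≡⟨ sym (ℕ.+-suc x (ℕ.pred q)) ⟩
    x + suc (ℕ.pred q)                           ≡⟨ cong (λ p → x + p) (ℕ.suc-pred q) ⟩
    x + q                                        ≈⟨ +-cong-≋ {x} refl q≋0 ⟩
    x + 0                                        ≡⟨ ℕ.+-identityʳ x ⟩
    x                                            ∎)

  +≋0⇔≋neg : ∀ x y → x + y ≋ 0 ⇔ y ≋ neg x
  +≋0⇔≋neg x y = mk⇔ (ℤqGroup.inverseʳ-unique x y)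
    (λ y≋-x → trans (+-cong-≋ {x} refl y≋-x) (ℤq.-‿inverseʳ x))

  neg-*-neg : ∀ x y → neg x * neg y ≋ x * y
  neg-*-neg x y = begin
    neg x * neg y        ≈⟨ ℤqRing.-‿distribˡ-* x (neg y) ⟨
    neg (x * neg y)      ≈⟨ ℤq.-‿cong (ℤqRing.-‿distribʳ-* x y) ⟨
    neg (neg (x * y))    ≈⟨ ℤqGroup.⁻¹-involutive (x * y) ⟩
    x * y                ∎

  inverse-unique : ∀ a b → a * b ≋ 1 → ∀ c → a * c ≋ 1 ⇔ c ≋ b
  inverse-unique a b ab≋1 c = mk⇔ ac≋1⇒c≋b (λ c≋b → trans (*-cong-≋ {a} refl c≋b) ab≋1)
    where
    ac≋1⇒c≋b : a * c ≋ 1 → c ≋ b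
    ac≋1⇒c≋b ac≋1 = begin
      c              ≈⟨ ℤq.*-identityˡ c ⟨
      1 * c          ≈⟨ ℤq.*-congʳ ab≋1 ⟨
      (a * b) * c    ≡⟨ trans (cong (_* c) (ℕ.*-comm a b)) (ℕ.*-assoc b a c) ⟩
      b * (a * c)    ≈⟨ ℤq.*-congˡ {b} ac≋1 ⟩
      b * 1          ≈⟨ ℤq.*-identityʳ b ⟩
      b              ∎

  invertible⇒coprime : ∀ a b → a * b ≋ 1 → gcd a q ≡ 1
  invertible⇒coprime a b ab≋1 =
    ∣1⇒≡1 (subst (gcd a q ∣_) (sym (m≡m%n+[m/n]*n 1 q))
      (∣m∣n⇒∣m+n g∣1%q (∣n⇒∣m*n (1 / q) (gcd[m,n]∣n a q))))
    where
    g∣1%q : gcd a q ∣ 1 % q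
    g∣1%q = subst (gcd a q ∣_) ab≋1
      (%-presˡ-∣ (∣m⇒∣m*n b (gcd[m,n]∣m a q)) (gcd[m,n]∣n a q))

  coprime⇒invertible : ∀ a → gcd a q ≡ 1 → ∃ λ b → a * b ≋ 1
  coprime⇒invertible a gcd≡1 with coprime-Bézout (gcd≡1⇒coprime gcd≡1)
  ... | Bézout.+- x y 1+yq≡xa = x , (begin
    a * x           ≡⟨ ℕ.*-comm a x ⟩
    x * a           ≡⟨ sym 1+yq≡xa ⟩
    1 + y * q       ≈⟨ [m+kn]%n≡m%n 1 y q ⟩
    1               ∎)
  ... | Bézout.-+ x y 1+xa≡yq = neg x , (begin
    a * neg x       ≈⟨ ℤqRing.-‿distribʳ-* a x ⟨
    neg (a * x)     ≈⟨ ℤq.-‿cong (ℤqGroup.inverseʳ-unique 1 (a * x) 1+ax≋0) ⟩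
    neg (neg 1)     ≈⟨ ℤqGroup.⁻¹-involutive 1 ⟩
    1               ∎)
    where
    1+ax≋0 : 1 + a * x ≋ 0
    1+ax≋0 = trans (≡⇒≋ (trans (cong (λ p → 1 + p) (ℕ.*-comm a x)) 1+xa≡yq)) (trans (m*n%n≡0 y q) (sym 0%q≡0))

  inverse-cong : ∀ {b c} → b ≋ c → ∀ x → b * x ≋ 1 ⇔ c * x ≋ 1
  inverse-cong b≋c x = mk⇔ (trans (*-cong-≋ (sym b≋c) refl)) (trans (*-cong-≋ b≋c refl))

module KloostermanSquare {c ℓ : Level} (R : CommutativeRing c ℓ) (q : ℕ) .{{_ : NonZero q}}
  (ζ : CommutativeRing.Carrier R) (ζ-primitive : InRing.IsPrimitiveRoot R q ζ) where
  open CommutativeRing R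
  open InRing R
  open WithRoot q ζ
  open Sums R
  open Residues q
  open SetoidReasoning setoid

  ζ^_ : ℕ → Carrier
  ζ^_ = pow ζ

  ζ^-+ : ∀ x y → ζ^ (x ℕ.+ y) ≈ ζ^ x * ζ^ y
  ζ^-+ ℕ.zero    y = sym (*-identityˡ _)
  ζ^-+ (ℕ.suc x) y = trans (*-congˡ (ζ^-+ x y)) (sym (*-assoc ζ _ _))

  ζ^-*q : ∀ j → ζ^ (j ℕ.* q) ≈ 1#
  ζ^-*q ℕ.zero    = refl
  ζ^-*q (ℕ.suc j) = begin
    ζ^ (q ℕ.+ j ℕ.* q)     ≈⟨ ζ^-+ q (j ℕ.* q) ⟩
    ζ^ q * ζ^ (j ℕ.* q)    ≈⟨ *-cong (proj₁ ζ-primitive) (ζ^-*q j) ⟩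
    1# * 1#                ≈⟨ *-identityˡ 1# ⟩
    1#                     ∎

  ζ^-% : ∀ x → ζ^ x ≈ ζ^ (x ℕ.% q)
  ζ^-% x = begin
    ζ^ x                                 ≡⟨ ≡.cong ζ^_ (m≡m%n+[m/n]*n x q) ⟩
    ζ^ (x ℕ.% q ℕ.+ (x ℕ./ q) ℕ.* q)     ≈⟨ ζ^-+ (x ℕ.% q) _ ⟩
    ζ^ (x ℕ.% q) * ζ^ ((x ℕ./ q) ℕ.* q)  ≈⟨ *-congˡ (ζ^-*q (x ℕ./ q)) ⟩
    ζ^ (x ℕ.% q) * 1#                    ≈⟨ *-identityʳ _ ⟩
    ζ^ (x ℕ.% q)                         ∎

  ζ^-cong : ∀ {x y} → x ≋ y → ζ^ x ≈ ζ^ y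
  ζ^-cong {x} {y} x≋y = trans (ζ^-% x) (trans (reflexive (≡.cong ζ^_ x≋y)) (sym (ζ^-% y)))

  -- Opaque, so that Agda can infer f from Σ₁ f.
  opaque
    Σ₁ : (ℕ → Carrier) → Carrier
    Σ₁ f = ∑[ i < q ] f (ℕ.suc (toℕ i))

    Σ₁-cong : ∀ {f g : ℕ → Carrier} → (∀ k → f k ≈ g k) → Σ₁ f ≈ Σ₁ g
    Σ₁-cong f≈g = sum-cong-≋ {q} (λ i → f≈g (ℕ.suc (toℕ i)))

    Σ₁-zero : ∀ {f : ℕ → Carrier} → (∀ k → f k ≈ 0#) → Σ₁ f ≈ 0#
    Σ₁-zero f≈0 = trans (Σ₁-cong f≈0) (SemiringSum.sum-replicate-zero semiring q)

    Σ₁-*ˡ : ∀ x (f : ℕ → Carrier) → x * Σ₁ f ≈ Σ₁ (λ k → x * f k)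
    Σ₁-*ˡ x f = *-distribˡ-sum {q} x (f ∘ ℕ.suc ∘ toℕ)

    Σ₁-*ʳ : ∀ x (f : ℕ → Carrier) → Σ₁ f * x ≈ Σ₁ (λ k → f k * x)
    Σ₁-*ʳ x f = *-distribʳ-sum {q} x (f ∘ ℕ.suc ∘ toℕ)

    Σ₁-comm : ∀ (f : ℕ → ℕ → Carrier) → Σ₁ (λ x → Σ₁ (f x)) ≈ Σ₁ (λ y → Σ₁ (λ x → f x y))
    Σ₁-comm f = ∑-comm {q} {q} (λ i j → f (ℕ.suc (toℕ i)) (ℕ.suc (toℕ j)))

    Σ₁-product-comm : ∀ (f g : ℕ → ℕ → Carrier) →
      Σ₁ (λ k → Σ₁ (f k) * Σ₁ (g k)) ≈ Σ₁ (λ x → Σ₁ (λ y → Σ₁ (λ k → f k x * g k y)))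
    Σ₁-product-comm f g = ∑-product-comm {q} {q} {q}
      (λ t i → f (ℕ.suc (toℕ t)) (ℕ.suc (toℕ i))) (λ t j → g (ℕ.suc (toℕ t)) (ℕ.suc (toℕ j)))

    Σ₁-range1 : ∀ f → Σ (range1 q) f ≈ Σ₁ f
    Σ₁-range1 f = trans (Σ-map ℕ.suc (upTo q) f) (Σ-applyUpTo id q (f ∘ ℕ.suc))

    Σ₁-1# : Σ₁ (λ _ → 1#) ≈ fromℕ q
    Σ₁-1# = ∑-1# q

    Σ₁-periodic : ∀ f → f q ≈ f 0 → Σ₁ f ≈ Σ (upTo q) f
    Σ₁-periodic f fq≈f0 = trans (∑-shift q f fq≈f0) (sym (Σ-applyUpTo id q f))

    Σ₁-select : ∀ {p} {P : U.Pred ℕ p} (P? : U.Decidable P) r → (∀ x → P x ⇔ x ≋ r) →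
                (g : ℕ → Carrier) → (∀ {x y} → x ≋ y → g x ≈ g y) →
                Σ₁ (λ x → 𝟙 (P? x) * g x) ≈ g r
    Σ₁-select {P = P} P? r P⇔≋r g g-cong with representative r
    ... | i , 1+i≋r = begin
      Σ₁ (λ x → 𝟙 (P? x) * g x)  ≈⟨ ∑-δ _ i (λ j j≢i → 𝟙-*-no (P? _) (j≢i ∘ selects-only-i j)) ⟩
      𝟙 (P? r₀) * g r₀          ≈⟨ 𝟙-*-yes (P? r₀) (Equivalence.from (P⇔≋r r₀) 1+i≋r) ⟩
      g r₀                      ≈⟨ g-cong 1+i≋r ⟩
      g r                       ∎
      where
      r₀ : ℕ
      r₀ = ℕ.suc (toℕ i)
      selects-only-i : ∀ j → P (ℕ.suc (toℕ j)) → j ≡ i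
      selects-only-i j Pj = suc-≋-injective j i (≡.trans (Equivalence.to (P⇔≋r _) Pj) (≡.sym 1+i≋r))

  orthogonality : ∀ c → Σ₁ (λ k → ζ^ (k ℕ.* c)) ≈ 𝟙 (c ≋? 0) * fromℕ q
  orthogonality c with c ≋? 0
  ... | yes c≋0 = begin
    Σ₁ (λ k → ζ^ (k ℕ.* c))
      ≈⟨ Σ₁-cong (λ k → ζ^-cong (≡.trans (*-cong-≋ {k} ≡.refl c≋0) (≡⇒≋ (ℕ.*-zeroʳ k)))) ⟩
    Σ₁ (λ _ → 1#)             ≈⟨ Σ₁-1# ⟩
    fromℕ q                   ≈⟨ *-identityˡ _ ⟨
    1# * fromℕ q              ∎
  ... | no c≉0 = begin
    Σ₁ (λ k → ζ^ (k ℕ.* c))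
      ≈⟨ Σ₁-periodic (λ k → ζ^ (k ℕ.* c)) (ζ^-cong (*-cong-≋ q≋0 (≡.refl {x = c ℕ.% q}))) ⟩
    Σ (upTo q) (λ j → ζ^ (j ℕ.* c))    ≈⟨ proj₂ ζ-primitive c q∤c ⟩
    0#                                 ≈⟨ zeroˡ _ ⟨
    0# * fromℕ q                       ∎
    where
    q∤c : ¬ (q ∣ c)
    q∤c q∣c = c≉0 (≡.trans (n∣m⇒m%n≡0 c q q∣c) (≡.sym 0%q≡0))

  e≈ζ^ : ∀ x t s → x ℤ.+ + s ≡ + t → s ≋ 0 → e x ≈ ζ^ t
  e≈ζ^ x t s x+s≡t s≋0 = ζ^-cong (x+s≡t⇒x%q≋t x t s x+s≡t s≋0)

  kloostermanTerm : ℕ → ℕ → ℕ → ℕ → Carrier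
  kloostermanTerm m c a a' = 𝟙 (a ℕ.* a' ≋? 1) * ζ^ (m ℕ.* a ℕ.+ c ℕ.* a')

  S : ℕ → ℕ → Carrier
  S m c = Σ₁ λ a → Σ₁ λ a' → kloostermanTerm m c a a'

  coprime-absorbed : ∀ a (f : ℕ → Carrier) →
    𝟙 (gcd a q ℕ.≟ 1) * Σ₁ (λ b → 𝟙 (a ℕ.* b ≋? 1) * f b) ≈ Σ₁ (λ b → 𝟙 (a ℕ.* b ≋? 1) * f b)
  coprime-absorbed a f with gcd a q ℕ.≟ 1
  ... | yes _    = *-identityˡ _
  ... | no ¬cop = trans (zeroˡ _) (sym (Σ₁-zero (λ b → 𝟙-*-no (a ℕ.* b ≋? 1) (¬cop ∘ invertible⇒coprime a b))))

  kloosterman≈S : ∀ m c → kloosterman (+ m) (+ c) ≈ S m c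
  kloosterman≈S m c = begin
    kloosterman (+ m) (+ c)
      ≈⟨ Σ-cong (units q) (λ a → trans (Σ-filter (λ a' → a ℕ.* a' ≋? 1) (range1 q) _)
                                  (trans (Σ₁-range1 _) (Σ₁-cong (λ a' → *-congˡ (e-linear a a'))))) ⟩
    Σ (units q) (λ a → Σ₁ λ a' → kloostermanTerm m c a a')
      ≈⟨ trans (Σ-filter (λ a → gcd a q ℕ.≟ 1) (range1 q) _) (Σ₁-range1 _) ⟩
    Σ₁ (λ a → 𝟙 (gcd a q ℕ.≟ 1) * Σ₁ λ a' → kloostermanTerm m c a a')
      ≈⟨ Σ₁-cong (λ a → coprime-absorbed a (λ a' → ζ^ (m ℕ.* a ℕ.+ c ℕ.* a'))) ⟩
    S m c ∎
    where
    e-linear : ∀ a a' → e (+ m ℤ.* + a ℤ.+ + c ℤ.* + a') ≈ ζ^ (m ℕ.* a ℕ.+ c ℕ.* a')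
    e-linear a a' = e≈ζ^ (+ m ℤ.* + a ℤ.+ + c ℤ.* + a') (m ℕ.* a ℕ.+ c ℕ.* a') 0
      (≡.trans (ℤ.+-identityʳ _) (≡.sym (pos-linear m a c a'))) ≡.refl

  Σ₁-inverses : ∀ a → Σ₁ (λ b → 𝟙 (a ℕ.* b ≋? 1)) ≈ 𝟙 (gcd a q ℕ.≟ 1)
  Σ₁-inverses a with gcd a q ℕ.≟ 1
  ... | no ¬cop = Σ₁-zero (λ b → 𝟙-no (a ℕ.* b ≋? 1) (¬cop ∘ invertible⇒coprime a b))
  ... | yes cop with coprime⇒invertible a cop
  ...   | b₀ , ab₀≋1 = trans (Σ₁-cong (λ b → sym (*-identityʳ _)))
                         (Σ₁-select (λ b → a ℕ.* b ≋? 1) b₀ (inverse-unique a b₀ ab₀≋1) (λ _ → 1#) (λ _ → refl))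

  exponent-split : ∀ m n k a a' b b' →
    ζ^ (m ℕ.* a ℕ.+ k ℕ.* a') * ζ^ (k ℕ.* b ℕ.+ n ℕ.* b') ≈ ζ^ (m ℕ.* a ℕ.+ n ℕ.* b') * ζ^ (k ℕ.* (a' ℕ.+ b))
  exponent-split m n k a a' b b' = begin
    ζ^ (m ℕ.* a ℕ.+ k ℕ.* a') * ζ^ (k ℕ.* b ℕ.+ n ℕ.* b')   ≈⟨ ζ^-+ (m ℕ.* a ℕ.+ k ℕ.* a') (k ℕ.* b ℕ.+ n ℕ.* b') ⟨
    ζ^ ((m ℕ.* a ℕ.+ k ℕ.* a') ℕ.+ (k ℕ.* b ℕ.+ n ℕ.* b'))  ≡⟨ ≡.cong ζ^_ (rearrange m a k a' b n b') ⟩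
    ζ^ ((m ℕ.* a ℕ.+ n ℕ.* b') ℕ.+ k ℕ.* (a' ℕ.+ b))        ≈⟨ ζ^-+ (m ℕ.* a ℕ.+ n ℕ.* b') (k ℕ.* (a' ℕ.+ b)) ⟩
    ζ^ (m ℕ.* a ℕ.+ n ℕ.* b') * ζ^ (k ℕ.* (a' ℕ.+ b))       ∎
    where
    rearrange : ∀ m a k a' b n b' →
      (m ℕ.* a ℕ.+ k ℕ.* a') ℕ.+ (k ℕ.* b ℕ.+ n ℕ.* b') ≡ (m ℕ.* a ℕ.+ n ℕ.* b') ℕ.+ k ℕ.* (a' ℕ.+ b)
    rearrange = ℕ-Solver.solve-∀

  B²-term : ℕ → ℕ → ℕ → ℕ → ℕ → ℕ → Carrier
  B²-term m n a a' b b' =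
    (𝟙 (a ℕ.* a' ≋? 1) * 𝟙 (b ℕ.* b' ≋? 1)) * (ζ^ (m ℕ.* a ℕ.+ n ℕ.* b') * Σ₁ (λ k → ζ^ (k ℕ.* (a' ℕ.+ b))))

  ramanujanTerm : ℕ → ℕ → ℕ → Carrier
  ramanujanTerm m n a = fromℕ q * ζ^ (m ℕ.* a ℕ.+ n ℕ.* neg a)

  Bsq-expand : ∀ m n → Bsq m n ≈ Σ₁ λ a → Σ₁ λ a' → Σ₁ λ b → Σ₁ λ b' → B²-term m n a a' b b'
  Bsq-expand m n = begin
    Bsq m n
      ≈⟨ trans (Σ₁-range1 _) (Σ₁-cong (λ k → *-cong (kloosterman≈S m k) (kloosterman≈S k n))) ⟩
    Σ₁ (λ k → S m k * S k n)
      ≈⟨ Σ₁-product-comm (λ k a → Σ₁ (kloostermanTerm m k a)) (λ k b → Σ₁ (kloostermanTerm k n b)) ⟩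
    Σ₁ (λ a → Σ₁ λ b → Σ₁ λ k → Σ₁ (kloostermanTerm m k a) * Σ₁ (kloostermanTerm k n b))
      ≈⟨ Σ₁-cong (λ a → Σ₁-cong (λ b → Σ₁-product-comm (λ k → kloostermanTerm m k a) (λ k → kloostermanTerm k n b))) ⟩
    Σ₁ (λ a → Σ₁ λ b → Σ₁ λ a' → Σ₁ λ b' → Σ₁ λ k → kloostermanTerm m k a a' * kloostermanTerm k n b b')
      ≈⟨ Σ₁-cong (λ a → Σ₁-comm (λ b a' → Σ₁ λ b' → Σ₁ λ k → kloostermanTerm m k a a' * kloostermanTerm k n b b')) ⟩
    Σ₁ (λ a → Σ₁ λ a' → Σ₁ λ b → Σ₁ λ b' → Σ₁ λ k → kloostermanTerm m k a a' * kloostermanTerm k n b b')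
      ≈⟨ Σ₁-cong (λ a → Σ₁-cong (λ a' → Σ₁-cong (λ b → Σ₁-cong (λ b' → collect a a' b b')))) ⟩
    Σ₁ (λ a → Σ₁ λ a' → Σ₁ λ b → Σ₁ λ b' → B²-term m n a a' b b') ∎
    where
    open CommutativeSemigroupProperties *-commutativeSemigroup using (interchange)
    collect : ∀ a a' b b' → Σ₁ (λ k → kloostermanTerm m k a a' * kloostermanTerm k n b b') ≈ B²-term m n a a' b b'
    collect a a' b b' = begin
      Σ₁ (λ k → kloostermanTerm m k a a' * kloostermanTerm k n b b')
        ≈⟨ Σ₁-cong (λ k → trans (interchange _ _ _ _) (*-congˡ (exponent-split m n k a a' b b'))) ⟩
      Σ₁ (λ k → (𝟙 (a ℕ.* a' ≋? 1) * 𝟙 (b ℕ.* b' ≋? 1)) * (ζ^ (m ℕ.* a ℕ.+ n ℕ.* b') * ζ^ (k ℕ.* (a' ℕ.+ b))))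
        ≈⟨ trans (*-congˡ (Σ₁-*ˡ _ _)) (Σ₁-*ˡ _ _) ⟨
      B²-term m n a a' b b' ∎

  -- Orthogonality forces b ≡ −a', and then b' ≡ −a as the inverse of −a'.
  select-inverse-pair : ∀ m n a a' →
    Σ₁ (λ b → Σ₁ λ b' → B²-term m n a a' b b') ≈ 𝟙 (a ℕ.* a' ≋? 1) * ramanujanTerm m n a
  select-inverse-pair m n a a' = begin
    Σ₁ (λ b → Σ₁ λ b' → B²-term m n a a' b b')
      ≈⟨ Σ₁-cong (λ b → Σ₁-cong (λ b' → trans (*-congˡ (*-congˡ (orthogonality (a' ℕ.+ b))))
                                           (regroup 𝟙₁ (𝟙 (b ℕ.* b' ≋? 1)) _ (𝟙 (a' ℕ.+ b ≋? 0)) (fromℕ q)))) ⟩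
    Σ₁ (λ b → Σ₁ λ b' → 𝟙₁ * (𝟙 (a' ℕ.+ b ≋? 0) * g b b'))
      ≈⟨ trans (Σ₁-*ˡ 𝟙₁ _) (Σ₁-cong (λ b → trans (*-congˡ (Σ₁-*ˡ _ (g b))) (Σ₁-*ˡ 𝟙₁ _))) ⟨
    𝟙₁ * Σ₁ (λ b → 𝟙 (a' ℕ.+ b ≋? 0) * Σ₁ (g b))
      ≈⟨ 𝟙-*-cong (a ℕ.* a' ≋? 1) select-b-and-b' ⟩
    𝟙₁ * ramanujanTerm m n a ∎
    where
    𝟙₁ : Carrier
    𝟙₁ = 𝟙 (a ℕ.* a' ≋? 1)
    g : ℕ → ℕ → Carrier
    g b b' = 𝟙 (b ℕ.* b' ≋? 1) * (ζ^ (m ℕ.* a ℕ.+ n ℕ.* b') * fromℕ q)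
    regroup : ∀ u v z w Q → (u * v) * (z * (w * Q)) ≈ u * (w * (v * (z * Q)))
    regroup = solve 5 (λ u v z w Q → (u :* v) :* (z :* (w :* Q)) := u :* (w :* (v :* (z :* Q)))) refl
      where open NaturalCoefficientsSolver commutativeSemiring
    select-b-and-b' : a ℕ.* a' ≋ 1 → Σ₁ (λ b → 𝟙 (a' ℕ.+ b ≋? 0) * Σ₁ (g b)) ≈ ramanujanTerm m n a
    select-b-and-b' aa'≋1 = begin
      Σ₁ (λ b → 𝟙 (a' ℕ.+ b ≋? 0) * Σ₁ (g b))
        ≈⟨ Σ₁-select (λ b → a' ℕ.+ b ≋? 0) (neg a') (+≋0⇔≋neg a') (Σ₁ ∘ g)
             (λ {b} {c} b≋c → Σ₁-cong (λ b' →
                *-congʳ (𝟙-cong (b ℕ.* b' ≋? 1) (c ℕ.* b' ≋? 1) (inverse-cong b≋c b')))) ⟩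
      Σ₁ (g (neg a'))
        ≈⟨ Σ₁-select (λ b' → neg a' ℕ.* b' ≋? 1) (neg a) (inverse-unique (neg a') (neg a) -a'-a≋1)
             (λ b' → ζ^ (m ℕ.* a ℕ.+ n ℕ.* b') * fromℕ q)
             (λ b'≋c → *-congʳ (ζ^-cong (+-cong-≋ {m ℕ.* a} ≡.refl (*-cong-≋ {n} ≡.refl b'≋c)))) ⟩
      ζ^ (m ℕ.* a ℕ.+ n ℕ.* neg a) * fromℕ q
        ≈⟨ *-comm _ _ ⟩
      ramanujanTerm m n a ∎
      where
      -a'-a≋1 : neg a' ℕ.* neg a ≋ 1
      -a'-a≋1 = ≡.trans (neg-*-neg a' a) (≡.trans (≡⇒≋ (ℕ.*-comm a' a)) aa'≋1)

  qA-expand : ∀ m n → qA m n ≈ Σ₁ (λ a → 𝟙 (gcd a q ℕ.≟ 1) * ramanujanTerm m n a)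
  qA-expand m n = begin
    fromℕ q * Σ (units q) (λ a → e (+ a ℤ.* (+ m ℤ.- + n)))
      ≈⟨ *-congˡ (trans (Σ-filter (λ a → gcd a q ℕ.≟ 1) (range1 q) _) (Σ₁-range1 _)) ⟩
    fromℕ q * Σ₁ (λ a → 𝟙 (gcd a q ℕ.≟ 1) * e (+ a ℤ.* (+ m ℤ.- + n)))
      ≈⟨ Σ₁-*ˡ (fromℕ q) _ ⟩
    Σ₁ (λ a → fromℕ q * (𝟙 (gcd a q ℕ.≟ 1) * e (+ a ℤ.* (+ m ℤ.- + n))))
      ≈⟨ Σ₁-cong (λ a → trans (x∙yz≈y∙xz (fromℕ q) _ _) (*-congˡ (*-congˡ (e-ramanujan a)))) ⟩
    Σ₁ (λ a → 𝟙 (gcd a q ℕ.≟ 1) * ramanujanTerm m n a) ∎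
    where
    open CommutativeSemigroupProperties *-commutativeSemigroup using (x∙yz≈y∙xz)
    e-ramanujan : ∀ a → e (+ a ℤ.* (+ m ℤ.- + n)) ≈ ζ^ (m ℕ.* a ℕ.+ n ℕ.* neg a)
    e-ramanujan a = e≈ζ^ (+ a ℤ.* (+ m ℤ.- + n)) (m ℕ.* a ℕ.+ n ℕ.* neg a) (n ℕ.* (a ℕ.+ neg a))
      (a[m-n]+n[a+b]≡ma+nb a m n (neg a))
      (≡.trans (*-cong-≋ {n} ≡.refl (Equivalence.from (+≋0⇔≋neg a (neg a)) ≡.refl)) (≡⇒≋ (ℕ.*-zeroʳ n)))

  Bsq≈qA : ∀ m n → Bsq m n ≈ qA m n
  Bsq≈qA m n = begin
    Bsq m n
      ≈⟨ Bsq-expand m n ⟩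
    Σ₁ (λ a → Σ₁ λ a' → Σ₁ λ b → Σ₁ λ b' → B²-term m n a a' b b')
      ≈⟨ Σ₁-cong (λ a → Σ₁-cong (λ a' → select-inverse-pair m n a a')) ⟩
    Σ₁ (λ a → Σ₁ λ a' → 𝟙 (a ℕ.* a' ≋? 1) * ramanujanTerm m n a)
      ≈⟨ Σ₁-cong (λ a → trans (sym (Σ₁-*ʳ (ramanujanTerm m n a) _)) (*-congʳ (Σ₁-inverses a))) ⟩
    Σ₁ (λ a → 𝟙 (gcd a q ℕ.≟ 1) * ramanujanTerm m n a)
      ≈⟨ qA-expand m n ⟨
    qA m n ∎

lemma10 : {c ℓ : Level} (R : CommutativeRing c ℓ) (q : ℕ) .{{_ : NonZero q}}
          (ζ : CommutativeRing.Carrier R) →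
          InRing.IsPrimitiveRoot R q ζ →
          (m n : ℕ) → 1 ≤ m → m ≤ q → 1 ≤ n → n ≤ q →
          CommutativeRing._≈_ R (InRing.WithRoot.Bsq R q ζ m n) (InRing.WithRoot.qA R q ζ m n)
lemma10 R q ζ ζ-primitive m n _ _ _ _ = KloostermanSquare.Bsq≈qA R q ζ ζ-primitive m n
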